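{- For every $n\in\mathbb{N}$, the number of colourability sinks in $\{0,1\}^n$ equals the number of colourability sources in $\{0,1\}^n$.
   Context: $\#w$ is the length, $\varepsilon$ the empty string; for $\#w\ge1$, $l(w)$ is $w$ without its last letter and $r(w)$ is $w$ without its first letter. $T^n$ is the alternating string of length $n$ starting with $0$ ($T^0=\varepsilon$, $T^n=T^{n-1}0$ for odd $n$, $T^n=T^{n-1}1$ for even $n\ge2$) and $CT^n$ its letterwise complement. $\xi$: $\xi(\varepsilon)=0$; $\xi(w)=1$ if $w=T^k$, $k\ge2$ even; $\xi(w)=-1$ if $w=CT^k$, $k\ge2$ even; otherwise $\xi(w)=\operatorname{sgn}(\xi(l(w))+\xi(r(w)))$. $\phi$: $\phi(\varepsilon)=0$; $\phi(w)=-1$ if $w=0^k$, $k$ odd; $\phi(w)=1$ if $w=1^k$, $k$ odd; otherwise $\phi(w)=\operatorname{sgn}(\phi(r(w))-\phi(l(w)))$. $\psi(w)=\xi(w)^{\#w}\phi(w)$ (with $0^0=1$); $w$ is colourable iff $\psi(w)\ne0$. A string $w$ is a colourability sink if neither $w0$ nor $w1$ is colourable, and a colourability source if neither $0w$ nor $1w$ is colourable. -}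

module Defs where

open import Data.Bool using (Bool; true; false; not; _∧_; if_then_else_)
open import Data.Bool.Properties renaming (_≟_ to _≟B_)
open import Data.Nat using (ℕ; zero; suc)
open import Data.Integer using (ℤ; +_; -_; _+_; _-_; _*_; _^_; -[1+_]; +[1+_])
import Data.Integer.Properties as ℤP
open import Data.Vec using (Vec; []; _∷_; _∷ʳ_; replicate; map; tail)
open import Data.Vec.Properties using (≡-dec)
open import Data.List using (List; length; filter; concatMap)
import Data.List as L
open import Relation.Nullary using (¬_; Dec; yes; no)
open import Relation.Nullary.Decidable using (⌊_⌋; ¬?; _×-dec_)
open import Relation.Binary.PropositionalEquality using (_≡_)
open import Data.Product using (_×_)

-- Binary strings of length n: letter 0 = false, letter 1 = true.
Str : ℕ → Set
Str n = Vec Bool n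

l : ∀ {n} → Str (suc n) → Str n
l (x ∷ []) = []
l (x ∷ y ∷ ys) = x ∷ l (y ∷ ys)

r : ∀ {n} → Str (suc n) → Str n
r = tail

isEven : ℕ → Bool
isEven zero = true
isEven (suc n) = not (isEven n)

isOdd : ℕ → Bool
isOdd n = not (isEven n)

-- T^n: alternating string starting with 0; T^n = T^{n-1}0 (n odd), T^{n-1}1 (n even ≥ 2)
T : (n : ℕ) → Str n
T zero = []
T (suc n) = T n ∷ʳ isEven (suc n)

CT : (n : ℕ) → Str n
CT n = map not (T n)

_≟S_ : ∀ {n} → (u v : Str n) → Dec (u ≡ v)
_≟S_ = ≡-dec _≟B_

sgn : ℤ → ℤ
sgn (+ zero) = + 0
sgn +[1+ _ ] = + 1
sgn -[1+ _ ] = - (+ 1)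

ξ : (n : ℕ) → Str n → ℤ
ξ zero w = + 0
ξ (suc n) w =
  if isEven (suc n) ∧ ⌊ w ≟S T (suc n) ⌋ then + 1
  else if isEven (suc n) ∧ ⌊ w ≟S CT (suc n) ⌋ then - (+ 1)
  else sgn (ξ n (l w) + ξ n (r w))

φ : (n : ℕ) → Str n → ℤ
φ zero w = + 0
φ (suc n) w =
  if isOdd (suc n) ∧ ⌊ w ≟S replicate (suc n) false ⌋ then - (+ 1)
  else if isOdd (suc n) ∧ ⌊ w ≟S replicate (suc n) true ⌋ then + 1
  else sgn (φ n (r w) - φ n (l w))

-- ψ(w) = ξ(w)^{#w} φ(w)   (with 0^0 = 1, as in ℤ's _^_)
ψ : (n : ℕ) → Str n → ℤ
ψ n w = (ξ n w ^ n) * φ n w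

Colourable : ∀ {n} → Str n → Set
Colourable {n} w = ¬ (ψ n w ≡ + 0)

colourable? : ∀ {n} → (w : Str n) → Dec (Colourable w)
colourable? {n} w = ¬? (ψ n w ℤP.≟ + 0)

Sink : ∀ {n} → Str n → Set
Sink w = ¬ Colourable (w ∷ʳ false) × ¬ Colourable (w ∷ʳ true)

sink? : ∀ {n} → (w : Str n) → Dec (Sink w)
sink? w = ¬? (colourable? (w ∷ʳ false)) ×-dec ¬? (colourable? (w ∷ʳ true))

Source : ∀ {n} → Str n → Set
Source w = ¬ Colourable (false ∷ w) × ¬ Colourable (true ∷ w)

source? : ∀ {n} → (w : Str n) → Dec (Source w)
source? w = ¬? (colourable? (false ∷ w)) ×-dec ¬? (colourable? (true ∷ w))

allStr : (n : ℕ) → List (Str n)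
allStr zero = [] L.∷ L.[]
allStr (suc n) = L.map (false ∷_) (allStr n) L.++ L.map (true ∷_) (allStr n)

#sinks : ℕ → ℕ
#sinks n = length (filter sink? (allStr n))

#sources : ℕ → ℕ
#sources n = length (filter source? (allStr n))

-- Reversal w ↦ wᴿ is a bijection of {0,1}ⁿ, and it swaps appending a letter with prepending it:
-- (wx)ᴿ = x wᴿ.  So it suffices that colourability is reversal invariant.  Reversal swaps l and r
-- and maps Tᵏ to CTᵏ for even k, which makes ξ odd under reversal, ξ(wᴿ) = −ξ(w); reversal fixes
-- 0ᵏ and 1ᵏ, which makes φ(wᴿ) = ±φ(w).  Hence |ψ(wᴿ)| = |ψ(w)|, and w is colourable iff wᴿ is.
module Submission where

open import Defs
open import Data.Bool using (Bool; true; false; not; _∧_; if_then_else_)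
open import Data.Bool.Properties using (not-involutive)
open import Data.Empty using (⊥; ⊥-elim)
open import Data.Integer as ℤ using (ℤ; +_; -_; _+_; _-_; _^_; ∣_∣; 1ℤ; +[1+_]; -[1+_])
import Data.Integer.Properties as ℤ
open import Data.List as List using (List; length; filter)
import Data.List.Properties as List
open import Data.Nat as ℕ using (ℕ; zero; suc)
import Data.Nat.Properties as ℕ
open import Algebra.Properties.CommutativeSemigroup ℕ.+-commutativeSemigroup using (interchange)
open import Data.Product.Function.NonDependent.Propositional using (_×-⇔_)
open import Data.Vec using (Vec; []; _∷_; _∷ʳ_; replicate; map; reverse)
open import Data.Vec.Properties
  using (reverse-∷; reverse-involutive; reverse-reverse; reverse-injective; map-∷ʳ; map-∘; map-cong; map-id)
open import Function using (_∘_; _⇔_; mk⇔; Equivalence)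
open import Relation.Nullary using (¬_; yes; no; does)
open import Relation.Nullary.Decidable using (⌊_⌋; isYes≗does; does-⇔)
open import Relation.Unary using (Decidable)
open import Relation.Binary.PropositionalEquality
  using (_≡_; _≢_; refl; sym; trans; cong; cong₂; subst; _≗_; module ≡-Reasoning)

private
  variable
    A : Set
    n : ℕ

open ≡-Reasoning

reverse-∷ʳ : ∀ (x : A) (xs : Vec A n) → reverse (xs ∷ʳ x) ≡ x ∷ reverse xs
reverse-∷ʳ x xs = begin
  reverse (xs ∷ʳ x)                   ≡⟨ cong (λ ys → reverse (ys ∷ʳ x)) (reverse-involutive xs) ⟨
  reverse (reverse (reverse xs) ∷ʳ x) ≡⟨ cong reverse (reverse-∷ x (reverse xs)) ⟨
  reverse (reverse (x ∷ reverse xs))  ≡⟨ reverse-involutive (x ∷ reverse xs) ⟩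
  x ∷ reverse xs                      ∎

replicate-∷ʳ : ∀ n (x : A) → replicate n x ∷ʳ x ≡ x ∷ replicate n x
replicate-∷ʳ zero    x = refl
replicate-∷ʳ (suc n) x = cong (x ∷_) (replicate-∷ʳ n x)

reverse-replicate : ∀ n (x : A) → reverse (replicate n x) ≡ replicate n x
reverse-replicate zero    x = refl
reverse-replicate (suc n) x = begin
  reverse (x ∷ replicate n x)   ≡⟨ reverse-∷ x (replicate n x) ⟩
  reverse (replicate n x) ∷ʳ x  ≡⟨ cong (_∷ʳ x) (reverse-replicate n x) ⟩
  replicate n x ∷ʳ x            ≡⟨ replicate-∷ʳ n x ⟩
  x ∷ replicate n x             ∎

l-∷ʳ : ∀ (w : Str n) x → l (w ∷ʳ x) ≡ w
l-∷ʳ []          x = refl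
l-∷ʳ (y ∷ [])    x = refl
l-∷ʳ (y ∷ z ∷ w) x = cong (y ∷_) (l-∷ʳ (z ∷ w) x)

l-reverse : ∀ (w : Str (suc n)) → l (reverse w) ≡ reverse (r w)
l-reverse (x ∷ w) = trans (cong l (reverse-∷ x w)) (l-∷ʳ (reverse w) x)

r-reverse : ∀ (w : Str (suc n)) → r (reverse w) ≡ reverse (l w)
r-reverse w = reverse-injective (begin
  reverse (r (reverse w)) ≡⟨ l-reverse (reverse w) ⟨
  l (reverse (reverse w)) ≡⟨ cong l (reverse-involutive w) ⟩
  l w                     ≡⟨ reverse-involutive (l w) ⟨
  reverse (reverse (l w)) ∎)

T-suc : ∀ n → T (suc n) ≡ false ∷ CT n
T-suc zero    = refl
T-suc (suc n) = begin
  T (suc n) ∷ʳ isEven (suc (suc n))               ≡⟨ cong (_∷ʳ isEven (suc (suc n))) (T-suc n) ⟩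
  false ∷ (map not (T n) ∷ʳ not (isEven (suc n))) ≡⟨ cong (false ∷_) (map-∷ʳ not _ (T n)) ⟨
  false ∷ CT (suc n)                              ∎

CT-suc : ∀ n → CT (suc n) ≡ true ∷ T n
CT-suc n = begin
  map not (T (suc n))          ≡⟨ cong (map not) (T-suc n) ⟩
  true ∷ map not (CT n)        ≡⟨ cong (true ∷_) (map-∘ not not (T n)) ⟨
  true ∷ map (not ∘ not) (T n) ≡⟨ cong (true ∷_) (map-cong not-involutive (T n)) ⟩
  true ∷ map (λ b → b) (T n)   ≡⟨ cong (true ∷_) (map-id (T n)) ⟩
  true ∷ T n                   ∎

reverse-T : ∀ n → reverse (T n) ≡ (if isEven n then CT n else T n)
reverse-T zero    = refl
reverse-T (suc n) = begin
  reverse (T n ∷ʳ not (isEven n))                   ≡⟨ reverse-∷ʳ _ (T n) ⟩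
  not (isEven n) ∷ reverse (T n)                    ≡⟨ cong (not (isEven n) ∷_) (reverse-T n) ⟩
  not (isEven n) ∷ (if isEven n then CT n else T n) ≡⟨ prepend (isEven n) ⟩
  (if not (isEven n) then CT (suc n) else T (suc n)) ∎
  where
  prepend : ∀ e → not e ∷ (if e then CT n else T n) ≡ (if not e then CT (suc n) else T (suc n))
  prepend true  = sym (T-suc n)
  prepend false = sym (CT-suc n)

reverse-≟ : ∀ (w u : Str n) → ⌊ reverse w ≟S u ⌋ ≡ ⌊ w ≟S reverse u ⌋
reverse-≟ w u = begin
  ⌊ reverse w ≟S u ⌋    ≡⟨ isYes≗does (reverse w ≟S u) ⟩
  does (reverse w ≟S u) ≡⟨ does-⇔ (mk⇔ to from) (reverse w ≟S u) (w ≟S reverse u) ⟩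
  does (w ≟S reverse u) ≡⟨ isYes≗does (w ≟S reverse u) ⟨
  ⌊ w ≟S reverse u ⌋    ∎
  where
  to : reverse w ≡ u → w ≡ reverse u
  to p = trans (sym (reverse-involutive w)) (cong reverse p)
  from : w ≡ reverse u → reverse w ≡ u
  from p = trans (cong reverse p) (reverse-involutive u)

guard-cong : ∀ e {w u v : Str n} → (e ≡ true → u ≡ v) → e ∧ ⌊ w ≟S u ⌋ ≡ e ∧ ⌊ w ≟S v ⌋
guard-cong true  u≡v = cong (λ u → ⌊ _ ≟S u ⌋) (u≡v refl)
guard-cong false u≡v = refl

reverse-T-even : ∀ k → isEven k ≡ true → reverse (T k) ≡ CT k
reverse-T-even k even = trans (reverse-T k) (cong (λ e → if e then CT k else T k) even)

reverse-guardT : ∀ k (w : Str k) → isEven k ∧ ⌊ reverse w ≟S T k ⌋ ≡ isEven k ∧ ⌊ w ≟S CT k ⌋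
reverse-guardT k w =
  trans (cong (isEven k ∧_) (reverse-≟ w (T k))) (guard-cong (isEven k) (reverse-T-even k))

reverse-guardCT : ∀ k (w : Str k) → isEven k ∧ ⌊ reverse w ≟S CT k ⌋ ≡ isEven k ∧ ⌊ w ≟S T k ⌋
reverse-guardCT k w =
  trans (cong (isEven k ∧_) (reverse-≟ w (CT k)))
        (guard-cong (isEven k) (reverse-reverse ∘ reverse-T-even k))

T≢CT : ∀ n → T (suc n) ≢ CT (suc n)
T≢CT n p with trans (sym (T-suc n)) (trans p (CT-suc n))
... | ()

guardT-guardCT-disjoint : ∀ e k (w : Str (suc k)) →
  e ∧ ⌊ w ≟S T (suc k) ⌋ ≡ true → e ∧ ⌊ w ≟S CT (suc k) ⌋ ≡ true → ⊥
guardT-guardCT-disjoint true k w p q with w ≟S T (suc k) | w ≟S CT (suc k)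
... | yes refl | yes w≡CT = T≢CT k w≡CT

sgn-neg : ∀ i → sgn (- i) ≡ - sgn i
sgn-neg (+ zero) = refl
sgn-neg +[1+ n ] = refl
sgn-neg -[1+ n ] = refl

ξ-branches-negate : ∀ (A B : Bool) (x y : ℤ) → (A ≡ true → B ≡ true → ⊥) →
  (if B then 1ℤ else if A then - 1ℤ else sgn (- y + - x))
    ≡ - (if A then 1ℤ else if B then - 1ℤ else sgn (x + y))
ξ-branches-negate true  true  x y disjoint = ⊥-elim (disjoint refl refl)
ξ-branches-negate true  false x y disjoint = refl
ξ-branches-negate false true  x y disjoint = refl
ξ-branches-negate false false x y disjoint = begin
  sgn (- y + - x) ≡⟨ cong sgn (ℤ.neg-distrib-+ y x) ⟨
  sgn (- (y + x)) ≡⟨ cong (sgn ∘ -_) (ℤ.+-comm y x) ⟩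
  sgn (- (x + y)) ≡⟨ sgn-neg (x + y) ⟩
  - sgn (x + y)   ∎

ξ-reverse : ∀ n (w : Str n) → ξ n (reverse w) ≡ - ξ n w
ξ-reverse zero    [] = refl
ξ-reverse (suc n) w
  rewrite reverse-guardT (suc n) w | reverse-guardCT (suc n) w
        | l-reverse w | r-reverse w | ξ-reverse n (r w) | ξ-reverse n (l w)
  = ξ-branches-negate _ _ (ξ n (l w)) (ξ n (r w)) (guardT-guardCT-disjoint (isEven (suc n)) n w)

reverse-guardReplicate : ∀ k (w : Str k) x →
  isOdd k ∧ ⌊ reverse w ≟S replicate k x ⌋ ≡ isOdd k ∧ ⌊ w ≟S replicate k x ⌋
reverse-guardReplicate k w x = cong (isOdd k ∧_) (begin
  ⌊ reverse w ≟S replicate k x ⌋   ≡⟨ reverse-≟ w (replicate k x) ⟩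
  ⌊ w ≟S reverse (replicate k x) ⌋ ≡⟨ cong (λ u → ⌊ w ≟S u ⌋) (reverse-replicate k x) ⟩
  ⌊ w ≟S replicate k x ⌋           ∎)

negateIf : Bool → ℤ → ℤ
negateIf e i = if e then - i else i

neg-minus : ∀ i j → - (i - j) ≡ j - i
neg-minus i j = begin
  - (i - j)   ≡⟨ ℤ.neg-distrib-+ i (- j) ⟩
  - i + - - j ≡⟨ cong (_+_ (- i)) (ℤ.neg-involutive j) ⟩
  - i + j     ≡⟨ ℤ.+-comm (- i) j ⟩
  j - i       ∎

φ-branches-negateIf : ∀ e (A B : Bool) (x y : ℤ) →
  (if not (not e) ∧ A then - 1ℤ else if not (not e) ∧ B then 1ℤ
   else sgn (negateIf e y - negateIf e x))
    ≡ negateIf (not e) (if not (not e) ∧ A then - 1ℤ else if not (not e) ∧ B then 1ℤ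
                        else sgn (x - y))
φ-branches-negateIf true  true  B     x y = refl
φ-branches-negateIf true  false true  x y = refl
φ-branches-negateIf true  false false x y =
  cong sgn (trans (sym (ℤ.neg-distrib-+ y (- x))) (neg-minus y x))
φ-branches-negateIf false A     B     x y =
  trans (cong sgn (sym (neg-minus x y))) (sgn-neg (x - y))

φ-reverse : ∀ n (w : Str n) → φ n (reverse w) ≡ negateIf (isEven n) (φ n w)
φ-reverse zero    [] = refl
φ-reverse (suc n) w
  rewrite reverse-guardReplicate (suc n) w false | reverse-guardReplicate (suc n) w true
        | l-reverse w | r-reverse w | φ-reverse n (r w) | φ-reverse n (l w)
  = φ-branches-negateIf (isEven n) _ _ (φ n (r w)) (φ n (l w))

∣i^n∣≡∣i∣^n : ∀ i n → ∣ i ^ n ∣ ≡ ∣ i ∣ ℕ.^ n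
∣i^n∣≡∣i∣^n i zero    = refl
∣i^n∣≡∣i∣^n i (suc n) = trans (ℤ.abs-* i (i ^ n)) (cong (∣ i ∣ ℕ.*_) (∣i^n∣≡∣i∣^n i n))

∣negateIf∣ : ∀ e i → ∣ negateIf e i ∣ ≡ ∣ i ∣
∣negateIf∣ true  i = ℤ.∣-i∣≡∣i∣ i
∣negateIf∣ false i = refl

∣ψ∣ : ∀ n (w : Str n) → ∣ ψ n w ∣ ≡ ∣ ξ n w ∣ ℕ.^ n ℕ.* ∣ φ n w ∣
∣ψ∣ n w = trans (ℤ.abs-* (ξ n w ^ n) (φ n w)) (cong (ℕ._* ∣ φ n w ∣) (∣i^n∣≡∣i∣^n (ξ n w) n))

∣ψ∣-reverse : ∀ n (w : Str n) → ∣ ψ n (reverse w) ∣ ≡ ∣ ψ n w ∣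
∣ψ∣-reverse n w = begin
  ∣ ψ n (reverse w) ∣                               ≡⟨ ∣ψ∣ n (reverse w) ⟩
  ∣ ξ n (reverse w) ∣ ℕ.^ n ℕ.* ∣ φ n (reverse w) ∣ ≡⟨ cong₂ (λ a b → a ℕ.^ n ℕ.* b) ∣ξ∣ ∣φ∣ ⟩
  ∣ ξ n w ∣ ℕ.^ n ℕ.* ∣ φ n w ∣                     ≡⟨ ∣ψ∣ n w ⟨
  ∣ ψ n w ∣                                         ∎
  where
  ∣ξ∣ : ∣ ξ n (reverse w) ∣ ≡ ∣ ξ n w ∣
  ∣ξ∣ = trans (cong ∣_∣ (ξ-reverse n w)) (ℤ.∣-i∣≡∣i∣ (ξ n w))
  ∣φ∣ : ∣ φ n (reverse w) ∣ ≡ ∣ φ n w ∣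
  ∣φ∣ = trans (cong ∣_∣ (φ-reverse n w)) (∣negateIf∣ (isEven n) (φ n w))

colourable-reverse : ∀ (w : Str n) → Colourable w ⇔ Colourable (reverse w)
colourable-reverse {n} w = mk⇔
  (λ c ψᴿ≡0 → c (ℤ.∣i∣≡0⇒i≡0 (trans (sym (∣ψ∣-reverse n w)) (cong ∣_∣ ψᴿ≡0))))
  (λ c ψ≡0 → c (ℤ.∣i∣≡0⇒i≡0 (trans (∣ψ∣-reverse n w) (cong ∣_∣ ψ≡0))))

uncolourable-∷ʳ : ∀ (w : Str n) x → (¬ Colourable (w ∷ʳ x)) ⇔ (¬ Colourable (x ∷ reverse w))
uncolourable-∷ʳ w x = mk⇔ (λ u → u ∘ from) (λ u → u ∘ to)
  where
  open Equivalence
    (subst (λ v → Colourable (w ∷ʳ x) ⇔ Colourable v) (reverse-∷ʳ x w) (colourable-reverse (w ∷ʳ x)))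

sink⇔source-reverse : ∀ (w : Str n) → Sink w ⇔ Source (reverse w)
sink⇔source-reverse w = uncolourable-∷ʳ w false ×-⇔ uncolourable-∷ʳ w true

count : ∀ n → (Str n → Bool) → ℕ
count zero    f = if f [] then 1 else 0
count (suc n) f = count n (f ∘ (false ∷_)) ℕ.+ count n (f ∘ (true ∷_))

count-cong : ∀ n {f g : Str n → Bool} → f ≗ g → count n f ≡ count n g
count-cong zero    f≗g = cong (λ b → if b then 1 else 0) (f≗g [])
count-cong (suc n) f≗g = cong₂ ℕ._+_ (count-cong n (f≗g ∘ (false ∷_))) (count-cong n (f≗g ∘ (true ∷_)))

count-∷ʳ : ∀ n (f : Str (suc n) → Bool) →
  count (suc n) f ≡ count n (f ∘ (_∷ʳ false)) ℕ.+ count n (f ∘ (_∷ʳ true))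
count-∷ʳ zero    f = refl
count-∷ʳ (suc n) f =
  trans (cong₂ ℕ._+_ (count-∷ʳ n (f ∘ (false ∷_))) (count-∷ʳ n (f ∘ (true ∷_))))
        (interchange (count n (λ v → f (false ∷ (v ∷ʳ false)))) (count n (λ v → f (false ∷ (v ∷ʳ true))))
                     (count n (λ v → f (true ∷ (v ∷ʳ false)))) (count n (λ v → f (true ∷ (v ∷ʳ true)))))

count-reverse : ∀ n (f : Str n → Bool) → count n (f ∘ reverse) ≡ count n f
count-reverse zero    f = refl
count-reverse (suc n) f = begin
  count n (f ∘ reverse ∘ (false ∷_)) ℕ.+ count n (f ∘ reverse ∘ (true ∷_))
    ≡⟨ cong₂ ℕ._+_ (count-cong n (cong f ∘ reverse-∷ false)) (count-cong n (cong f ∘ reverse-∷ true)) ⟩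
  count n (f ∘ (_∷ʳ false) ∘ reverse) ℕ.+ count n (f ∘ (_∷ʳ true) ∘ reverse)
    ≡⟨ cong₂ ℕ._+_ (count-reverse n (f ∘ (_∷ʳ false))) (count-reverse n (f ∘ (_∷ʳ true))) ⟩
  count n (f ∘ (_∷ʳ false)) ℕ.+ count n (f ∘ (_∷ʳ true))
    ≡⟨ count-∷ʳ n f ⟨
  count (suc n) f
    ∎

length-filter-map : ∀ {B : Set} {P : B → Set} (P? : Decidable P) (g : A → B) xs →
  length (filter P? (List.map g xs)) ≡ length (filter (P? ∘ g) xs)
length-filter-map P? g List.[] = refl
length-filter-map P? g (x List.∷ xs) with P? (g x)
... | yes _ = cong suc (length-filter-map P? g xs)
... | no  _ = length-filter-map P? g xs

length-filter-allStr : ∀ n {P : Str n → Set} (P? : Decidable P) →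
  length (filter P? (allStr n)) ≡ count n (does ∘ P?)
length-filter-allStr zero    P? with P? []
... | yes _ = refl
... | no  _ = refl
length-filter-allStr (suc n) P? = begin
  length (filter P? (List.map (false ∷_) xs List.++ List.map (true ∷_) xs))
    ≡⟨ cong length (List.filter-++ P? (List.map (false ∷_) xs) _) ⟩
  length (filter P? (List.map (false ∷_) xs) List.++ filter P? (List.map (true ∷_) xs))
    ≡⟨ List.length-++ (filter P? (List.map (false ∷_) xs)) ⟩
  length (filter P? (List.map (false ∷_) xs)) ℕ.+ length (filter P? (List.map (true ∷_) xs))
    ≡⟨ cong₂ ℕ._+_ (length-filter-map P? (false ∷_) xs) (length-filter-map P? (true ∷_) xs) ⟩
  length (filter (P? ∘ (false ∷_)) xs) ℕ.+ length (filter (P? ∘ (true ∷_)) xs)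
    ≡⟨ cong₂ ℕ._+_ (length-filter-allStr n (P? ∘ (false ∷_))) (length-filter-allStr n (P? ∘ (true ∷_))) ⟩
  count (suc n) (does ∘ P?)
    ∎
  where
  xs : List (Str n)
  xs = allStr n

corollary7p3 : (n : ℕ) → #sinks n ≡ #sources n
corollary7p3 n = begin
  #sinks n                           ≡⟨ length-filter-allStr n sink? ⟩
  count n (does ∘ sink?)             ≡⟨ count-cong n sinks-are-reversed-sources ⟩
  count n (does ∘ source? ∘ reverse) ≡⟨ count-reverse n (does ∘ source?) ⟩
  count n (does ∘ source?)           ≡⟨ length-filter-allStr n source? ⟨
  #sources n                         ∎
  where
  sinks-are-reversed-sources : does ∘ sink? ≗ does ∘ source? ∘ reverse
  sinks-are-reversed-sources w = does-⇔ (sink⇔source-reverse w) (sink? w) (source? (reverse w))
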